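{- Let $U=\{A_1,\dots,A_n\}$ be a relation scheme equipped with a schema context, let $r$ be a relation over it, and let $x,y\in L_U$. Then $r$ satisfies the abstract functional dependency $x\to y$ if and only if $L_r\models x\to y$.
   Context: A relation scheme is a finite set $U=\{A_1,\dots,A_n\}$ of attributes, each attribute $A$ having a domain $\mathrm{dom}(A)$. A schema context assigns to each attribute $A$ a finite lattice $L_A$ (its truth lattice) with bottom $0_A$ and top $1_A$, and a surjective comparability function $f_A:\mathrm{dom}(A)\times\mathrm{dom}(A)\to L_A$ with $f_A(u,u)=1_A$ and $f_A(u,v)=f_A(v,u)$. Let $L_U=\prod_{A\in U}L_A$ with the componentwise order; for $x\in L_U$, $x[A]$ is its $A$-component. A tuple $t$ assigns to each $A$ a value $t[A]\in\mathrm{dom}(A)$; a relation $r$ is a finite set of tuples. Put $f_U(t_1,t_2)=\langle f_{A_1}(t_1[A_1],t_2[A_1]),\dots,f_{A_n}(t_1[A_n],t_2[A_n])\rangle$, $f_U(r)=\{f_U(t_1,t_2): t_1,t_2\in r\}$ and $L_r=\{\bigwedge T: T\subseteq f_U(r)\}$ (meets in $L_U$, the empty meet being the top of $L_U$). An abstract functional dependency is a pair $x\to y$ with $x,y\in L_U$; $r$ satisfies it if for all $t_1,t_2\in r$, $x\le f_U(t_1,t_2)$ implies $y\le f_U(t_1,t_2)$. For a subset $L\subseteq L_U$, $L\models x\to y$ means: for every $z\in L$, $x\le z$ implies $y\le z$. -}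

module Defs where

open import Level using (0ℓ)
open import Data.Nat using (ℕ)
open import Data.Fin using (Fin)
open import Data.Product using (Σ; _×_; _,_; ∃)
open import Data.List using (List; []; _∷_; map)
open import Data.List.Relation.Unary.All using (All)
open import Data.List.Membership.Propositional using (_∈_)
open import Relation.Binary.Lattice.Bundles using (BoundedLattice)

record FiniteLattice : Set₁ where
  field
    bLattice  : BoundedLattice 0ℓ 0ℓ 0ℓ
  open BoundedLattice bLattice public
  field
    elements  : List Carrier
    complete  : ∀ (a : Carrier) → Σ Carrier (λ b → (b ∈ elements) × (a ≈ b))

record SchemaContext (n : ℕ) : Set₁ where
  field
    dom    : Fin n → Set
    L      : Fin n → FiniteLattice
    f      : (A : Fin n) → dom A → dom A → FiniteLattice.Carrier (L A)
    f-refl : ∀ A (u : dom A) → FiniteLattice._≈_ (L A) (f A u u) (FiniteLattice.⊤ (L A))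
    f-sym  : ∀ A (u v : dom A) → FiniteLattice._≈_ (L A) (f A u v) (f A v u)
    f-surj : ∀ A (a : FiniteLattice.Carrier (L A)) →
             Σ (dom A) (λ u → Σ (dom A) (λ v → FiniteLattice._≈_ (L A) (f A u v) a))

module _ {n : ℕ} (S : SchemaContext n) where
  open SchemaContext S

  LU : Set
  LU = (A : Fin n) → FiniteLattice.Carrier (L A)

  _≤U_ : LU → LU → Set
  x ≤U y = ∀ A → FiniteLattice._≤_ (L A) (x A) (y A)

  _≈U_ : LU → LU → Set
  x ≈U y = ∀ A → FiniteLattice._≈_ (L A) (x A) (y A)

  ⊤U : LU
  ⊤U A = FiniteLattice.⊤ (L A)

  _∧U_ : LU → LU → LU
  (x ∧U y) A = FiniteLattice._∧_ (L A) (x A) (y A)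

  ⋀U : List LU → LU
  ⋀U []       = ⊤U
  ⋀U (x ∷ xs) = x ∧U ⋀U xs

  Tuple : Set
  Tuple = (A : Fin n) → dom A

  -- a relation is a finite set of tuples, given as a list
  Relation : Set
  Relation = List Tuple

  fU : Tuple → Tuple → LU
  fU t₁ t₂ A = f A (t₁ A) (t₂ A)

  _∈fU_ : LU → Relation → Set
  z ∈fU r = Σ Tuple (λ t₁ → Σ Tuple (λ t₂ → (t₁ ∈ r) × (t₂ ∈ r) × (z ≈U fU t₁ t₂)))

  -- z ∈ L_r = { ⋀ T : T ⊆ f_U(r) }  (T a finite subset of f_U(r), given as a list)
  _∈Lr_ : LU → Relation → Set
  z ∈Lr r = Σ (List LU) (λ T → All (λ w → w ∈fU r) T × (z ≈U ⋀U T))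

  Satisfies : Relation → LU → LU → Set
  Satisfies r x y = ∀ t₁ t₂ → t₁ ∈ r → t₂ ∈ r → x ≤U fU t₁ t₂ → y ≤U fU t₁ t₂

  _⊨_⇒_ : (LU → Set) → LU → LU → Set
  P ⊨ x ⇒ y = ∀ z → P z → x ≤U z → y ≤U z

  Lr : Relation → LU → Set
  Lr r z = z ∈Lr r

module Submission where

-- An abstract functional dependency x → y "holds at" a point z of L_U when
-- x ≤ z implies y ≤ z.  The theorem compares two sets of points:
--   * r satisfies x → y  iff  x → y holds at every point of f_U(r), because
--     f_U(r) is by definition the set of values f_U(t₁,t₂) with t₁,t₂ ∈ r;
--   * x → y holds on f_U(r) iff it holds on L_r, the closure of f_U(r) under
--     finite meets: the points where x → y holds are closed under finite
--     meets (and under ≈), while f_U(r) ⊆ L_r via one-element meets.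

open import Defs
open import Data.Nat using (ℕ)
open import Data.Product using (_×_; _,_)
open import Data.List using ([]; _∷_)
open import Data.List.Relation.Unary.All as All using (All; []; _∷_)
import Relation.Binary.Lattice.Properties.BoundedMeetSemilattice as BoundedMeetProperties

module LatticeOfTruthValues {n : ℕ} (S : SchemaContext n) where
  open SchemaContext S

  infix 4 _≤_ _≈_
  _≤_ : LU S → LU S → Set
  _≤_ = _≤U_ S

  _≈_ : LU S → LU S → Set
  _≈_ = _≈U_ S

  ≤-trans : ∀ {x y z} → x ≤ y → y ≤ z → x ≤ z
  ≤-trans x≤y y≤z A = FiniteLattice.trans (L A) (x≤y A) (y≤z A)

  ≈⇒≤ : ∀ {x y} → x ≈ y → x ≤ y
  ≈⇒≤ x≈y A = FiniteLattice.reflexive (L A) (x≈y A)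

  ≈-refl : ∀ {x} → x ≈ x
  ≈-refl A = FiniteLattice.Eq.refl (L A)

  ≈-sym : ∀ {x y} → x ≈ y → y ≈ x
  ≈-sym x≈y A = FiniteLattice.Eq.sym (L A) (x≈y A)

  ∧⊤-identity : ∀ z → (_∧U_ S z (⊤U S)) ≈ z
  ∧⊤-identity z A = BoundedMeetProperties.identityʳ
    (FiniteLattice.boundedMeetSemilattice (L A)) (z A)

  ≤⋀⇒All≤ : ∀ {x} T → x ≤ ⋀U S T → All (x ≤_) T
  ≤⋀⇒All≤ []      _    = []
  ≤⋀⇒All≤ (w ∷ T) x≤⋀ =
    ≤-trans x≤⋀ (λ A → FiniteLattice.x∧y≤x (L A) (w A) (⋀U S T A))
    ∷ ≤⋀⇒All≤ T (≤-trans x≤⋀ (λ A → FiniteLattice.x∧y≤y (L A) (w A) (⋀U S T A)))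

  All≤⇒≤⋀ : ∀ {x} {T} → All (x ≤_) T → x ≤ ⋀U S T
  All≤⇒≤⋀ {x} []          A = FiniteLattice.maximum (L A) (x A)
  All≤⇒≤⋀     (x≤w ∷ x≤T) A = FiniteLattice.∧-greatest (L A) (x≤w A) (All≤⇒≤⋀ x≤T A)

module Dependencies {n : ℕ} (S : SchemaContext n) where
  open LatticeOfTruthValues S

  HoldsAt : LU S → LU S → LU S → Set
  HoldsAt x y z = x ≤ z → y ≤ z

  holdsAt-resp-≈ : ∀ {x y z z′} → z ≈ z′ → HoldsAt x y z → HoldsAt x y z′
  holdsAt-resp-≈ z≈z′ holds x≤z′ =
    ≤-trans (holds (≤-trans x≤z′ (≈⇒≤ (≈-sym z≈z′)))) (≈⇒≤ z≈z′)

  holdsAt-⋀ : ∀ {x y} T → All (HoldsAt x y) T → HoldsAt x y (⋀U S T)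
  holdsAt-⋀ T holdsOnT x≤⋀ =
    All≤⇒≤⋀ (All.zipWith (λ (holds , x≤w) → holds x≤w) (holdsOnT , ≤⋀⇒All≤ T x≤⋀))

  ⊨-antitone : ∀ {P Q : LU S → Set} {x y} →
    (∀ z → P z → Q z) → _⊨_⇒_ S Q x y → _⊨_⇒_ S P x y
  ⊨-antitone P⊆Q Q⊨ z Pz = Q⊨ z (P⊆Q z Pz)

  module _ (r : Relation S) where

    satisfies⇒⊨fU : ∀ {x y} → Satisfies S r x y → _⊨_⇒_ S (λ z → _∈fU_ S z r) x y
    satisfies⇒⊨fU sat z (t₁ , t₂ , t₁∈r , t₂∈r , z≈f) =
      holdsAt-resp-≈ (≈-sym z≈f) (sat t₁ t₂ t₁∈r t₂∈r)

    ⊨fU⇒satisfies : ∀ {x y} → _⊨_⇒_ S (λ z → _∈fU_ S z r) x y → Satisfies S r x y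
    ⊨fU⇒satisfies fU⊨ t₁ t₂ t₁∈r t₂∈r =
      fU⊨ (fU S t₁ t₂) (t₁ , t₂ , t₁∈r , t₂∈r , ≈-refl)

    -- f_U(r) ⊆ L_r, each z ∈ f_U(r) being the meet of the one-element family [z].
    fU⊆Lr : ∀ z → _∈fU_ S z r → Lr S r z
    fU⊆Lr z z∈fU = (z ∷ []) , (z∈fU ∷ []) , ≈-sym (∧⊤-identity z)

    ⊨fU⇒⊨Lr : ∀ {x y} → _⊨_⇒_ S (λ z → _∈fU_ S z r) x y → _⊨_⇒_ S (Lr S r) x y
    ⊨fU⇒⊨Lr fU⊨ z (T , T⊆fU , z≈⋀T) =
      holdsAt-resp-≈ (≈-sym z≈⋀T) (holdsAt-⋀ T (All.map (λ {w} → fU⊨ w) T⊆fU))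

open Dependencies

proposition1 : ∀ {n : ℕ} (S : SchemaContext n) (r : Relation S) (x y : LU S) →
    (Satisfies S r x y → _⊨_⇒_ S (Lr S r) x y) × (_⊨_⇒_ S (Lr S r) x y → Satisfies S r x y)
proposition1 S r x y =
    (λ sat → ⊨fU⇒⊨Lr S r (satisfies⇒⊨fU S r sat))
  , (λ Lr⊨ → ⊨fU⇒satisfies S r (⊨-antitone S (fU⊆Lr S r) Lr⊨))
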